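{- Let $G\neq1$ be a finite abelian group, $R\subseteq G$ with $R=R^{ -1}$, $1\notin R$, $|R|=2$, let $L=R$, and let $\Gamma=\mathrm{SC}(G;R,L,\{1\})$ be connected. Then $\Gamma$ is transitive, and the following are equivalent: (1) $\Gamma$ is normal; (2) $\Gamma$ is not arc-transitive; (3) $R=\{a,a^{ -1}\}$ where $a$ has order $k>2$ and $k\neq4$.
   Context: $\mathrm{SC}(G;R,L,\{1\})$ is the graph with vertex set $G\times\{1,2\}$ and edges $\{(x,1),(y,1)\}$ for $yx^{ -1}\in R$, $\{(x,2),(y,2)\}$ for $yx^{ -1}\in L$, and $\{(x,1),(x,2)\}$ for $x\in G$. $R_G=\{\rho_g\mid g\in G\}$ where $(x,i)^{\rho_g}=(xg,i)$; $\Gamma$ is normal if $R_G\trianglelefteq\mathrm{Aut}(\Gamma)$. Transitive means vertex-transitive; arc-transitive means $\mathrm{Aut}(\Gamma)$ is transitive on ordered pairs of adjacent vertices. -}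

module Defs where

open import Level using (Level; _⊔_)
open import Algebra.Bundles using (AbelianGroup)
open import Data.Nat using (ℕ; zero; suc; _<_)
open import Data.Fin using (Fin)
open import Data.Product using (_×_; Σ; ∃; ∃-syntax; _,_)
open import Data.Sum using (_⊎_)
open import Data.Empty using (⊥)
open import Relation.Nullary using (¬_)
open import Relation.Binary.PropositionalEquality using (_≡_; _≢_)
open import Relation.Binary.Construct.Closure.ReflexiveTransitive using (Star)
open import Function.Bundles using (_↔_; _⇔_; Inverse)

record IsFiniteAbelian {c ℓ : Level} (G : AbelianGroup c ℓ) : Set (c ⊔ ℓ) where
  open AbelianGroup G
  field
    ≈⇒≡    : ∀ x y → x ≈ y → x ≡ y
    size   : ℕ
    enum   : Fin size ↔ Carrier

module SC {c ℓ : Level} (G : AbelianGroup c ℓ) where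
  open AbelianGroup G

  pow : Carrier → ℕ → Carrier
  pow a zero    = ε
  pow a (suc n) = a ∙ pow a n

  HasOrder : Carrier → ℕ → Set c
  HasOrder a k = (0 < k) × (pow a k ≡ ε) × (∀ j → 0 < j → j < k → pow a j ≢ ε)

  -- vertex set G × {1,2}; Fin 2 with zero ↦ 1, suc zero ↦ 2
  Vertex : Set c
  Vertex = Carrier × Fin 2

  data Adj (R L : Carrier → Set c) : Vertex → Vertex → Set c where
    edge₁ : ∀ {x y} → R (y ∙ x ⁻¹) → Adj R L (x , Fin.zero) (y , Fin.zero)
    edge₂ : ∀ {x y} → L (y ∙ x ⁻¹) → Adj R L (x , Fin.suc Fin.zero) (y , Fin.suc Fin.zero)
    spoke₁₂ : ∀ {x} → Adj R L (x , Fin.zero) (x , Fin.suc Fin.zero)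
    spoke₂₁ : ∀ {x} → Adj R L (x , Fin.suc Fin.zero) (x , Fin.zero)

  module Graph (R L : Carrier → Set c) where
    E : Vertex → Vertex → Set c
    E = Adj R L

    Connected : Set c
    Connected = ∀ u v → Star E u v

    record Aut : Set c where
      field
        perm : Vertex ↔ Vertex
      open Inverse perm public
      field
        preserves : ∀ u v → E u v ⇔ E (to u) (to v)

    ρ : Carrier → Vertex → Vertex
    ρ g (x , i) = (x ∙ g , i)

    VertexTransitive : Set c
    VertexTransitive = ∀ u v → ∃[ σ ] Aut.to σ u ≡ v

    ArcTransitive : Set c
    ArcTransitive = ∀ u v u' v' → E u v → E u' v' →
      ∃[ σ ] (Aut.to σ u ≡ u' × Aut.to σ v ≡ v')

    -- R_G ⊴ Aut(Γ): every conjugate of every ρ_g lies in R_G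
    Normal : Set c
    Normal = ∀ (σ : Aut) (g : Carrier) →
      ∃[ h ] (∀ v → Aut.to σ (ρ g (Aut.from σ v)) ≡ ρ h v)

-- Translations ρ g and the swap of the two layers make Γ = SC(G;R,R,{1}) vertex-transitive.
-- Connectivity means that R generates G. Since R = {a , b} is closed under inversion, either
-- a² = b², or b = a⁻¹ and a² ≠ a⁻².
--
-- If a² = b², the rim Cay(G,R) is the 4-cycle ε — a — a b⁻¹ — b — ε, so Γ is the cube Q₃, which is
-- arc-transitive. An automorphism turning a rim arc into a spoke conjugates a translation into a
-- map that changes layers, so Γ is not normal; and x⁴ = 1 for every x ∈ R, so (3) fails.
--
-- Otherwise Γ is the prism over the cycle Cay(G,{a , a⁻¹}) of length k = ord a ∉ {1, 2, 4}.
-- A spoke lies on two four-cycles, a rim edge on only one (a closed non-backtracking rim walk of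
-- length 4 would force a⁴ = 1). Hence no automorphism maps a spoke to a rim edge, so Γ is not
-- arc-transitive, and every automorphism has the form (x , i) ↦ (f x , π i) with f an automorphism
-- of the rim cycle. Injectivity of f forces f (a x) = c · f x for a constant c, so f, and with it
-- the automorphism, normalises the translations.

module Submission where

open import Defs
open import Level using (Level; _⊔_; 0ℓ)
open import Algebra.Bundles using (AbelianGroup; Group)
import Algebra.Properties.AbelianGroup as AbelianGroupProperties
import Algebra.Properties.CommutativeSemigroup as CommutativeSemigroupProperties
open import Data.Bool using (Bool; true; false; not; _xor_)
open import Data.Bool.Properties
  using (not-distribˡ-xor; not-¬; xor-assoc; xor-same; xor-identityʳ)
open import Data.Empty using (⊥; ⊥-elim)
open import Data.Fin using (Fin; toℕ)
import Data.Fin as Fin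
open import Data.Fin.Patterns using (0F; 1F)
open import Data.Fin.Properties using (pigeonhole; 2↔Bool)
open import Data.Nat using (ℕ; zero; suc; _<_; _<?_; _+_; _*_; _∸_; s≤s; z≤n)
open import Data.Nat.Induction using (<-wellFounded)
open import Data.Nat.Properties using (anyUpTo?; n<1+n; m<n⇒0<n∸m; m∸n+n≡m; <⇒≤)
open import Data.Product using (_×_; ∃; ∃-syntax; _,_; proj₁; proj₂)
open import Data.Sum using (_⊎_; inj₁; inj₂)
open import Function.Base using (_∘_; id)
open import Function.Bundles using (_⇔_; _↔_; _↣_; Inverse; Injection; mk⇔; mk↔ₛ′; Equivalence)
open import Function.Properties.Inverse using (↔-sym; ↔-trans; ↔⇒↣)
open import Function.Construct.Composition using (_⇔-∘_)
open import Induction.WellFounded using (Acc; acc)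
open import Relation.Binary.Core using (Rel)
open import Relation.Binary.PropositionalEquality
open import Relation.Binary.Construct.Closure.ReflexiveTransitive using (Star; _◅_)
  renaming (ε to ε★)
open import Relation.Nullary using (¬_; Dec; yes; no)
open import Relation.Nullary.Decidable using (via-injection; _×-dec_)
open import Relation.Binary.Definitions using (DecidableEquality)
open import Relation.Unary using (Pred; Decidable)

least-witness : ∀ {p} {P : Pred ℕ p} → Decidable P → ∀ {n} → P n →
                ∃[ k ] (P k × ∀ {j} → j < k → ¬ P j)
least-witness {P = P} P? {n} = go n (<-wellFounded n)
  where
  go : ∀ n → Acc _<_ n → P n → ∃[ k ] (P k × ∀ {j} → j < k → ¬ P j)
  go n (acc rec) pn with anyUpTo? P? n
  ... | yes (m , m<n , pm) = go m (rec m<n) pm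
  ... | no  none           = n , pn , λ j<n pj → none (_ , j<n , pj)

record _≅_ {a b ℓ₁ ℓ₂} {A : Set a} {B : Set b} (E : Rel A ℓ₁) (F : Rel B ℓ₂)
         : Set (a ⊔ b ⊔ ℓ₁ ⊔ ℓ₂) where
  field
    bijection : A ↔ B
  open Inverse bijection public
  field
    preserves : ∀ u v → E u v ⇔ F (to u) (to v)

  map : ∀ {u v} → E u v → F (to u) (to v)
  map = Equivalence.to (preserves _ _)

  to-injective : ∀ {u v} → to u ≡ to v → u ≡ v
  to-injective {u} {v} eq =
    trans (sym (strictlyInverseʳ u)) (trans (cong from eq) (strictlyInverseʳ v))

mk≅ : ∀ {a b ℓ₁ ℓ₂} {A : Set a} {B : Set b} {E : Rel A ℓ₁} {F : Rel B ℓ₂} →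
      (to : A → B) (from : B → A) →
      (∀ y → to (from y) ≡ y) → (∀ x → from (to x) ≡ x) →
      (∀ {u v} → E u v → F (to u) (to v)) →
      (∀ {u v} → F u v → E (from u) (from v)) → E ≅ F
mk≅ {E = E} to from to∘from from∘to to-map from-map = record
  { bijection = mk↔ₛ′ to from to∘from from∘to
  ; preserves = λ u v → mk⇔ to-map
      (λ e → subst₂ E (from∘to u) (from∘to v) (from-map e))
  }

≅-sym : ∀ {a b ℓ₁ ℓ₂} {A : Set a} {B : Set b} {E : Rel A ℓ₁} {F : Rel B ℓ₂} →
        E ≅ F → F ≅ E
≅-sym {E = E} {F = F} φ = mk≅ from to strictlyInverseʳ strictlyInverseˡ from-map map
  where
  open _≅_ φ
  from-map : ∀ {u v} → F u v → E (from u) (from v)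
  from-map {u} {v} e =
    Equivalence.from (preserves (from u) (from v))
      (subst₂ F (sym (strictlyInverseˡ u)) (sym (strictlyInverseˡ v)) e)

≅-trans : ∀ {a b c ℓ₁ ℓ₂ ℓ₃} {A : Set a} {B : Set b} {C : Set c}
          {E : Rel A ℓ₁} {F : Rel B ℓ₂} {H : Rel C ℓ₃} → E ≅ F → F ≅ H → E ≅ H
≅-trans φ ψ = record
  { bijection = ↔-trans (_≅_.bijection φ) (_≅_.bijection ψ)
  ; preserves = λ u v → _≅_.preserves ψ _ _ ⇔-∘ _≅_.preserves φ u v
  }

IsArcTransitive : ∀ {a ℓ} {A : Set a} → Rel A ℓ → Set (a ⊔ ℓ)
IsArcTransitive E = ∀ u v u' v' → E u v → E u' v' →
  ∃[ σ ] (_≅_.to {E = E} {F = E} σ u ≡ u' × _≅_.to σ v ≡ v')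

module FourCycles {a ℓ} {V : Set a} (E : Rel V ℓ) where

  -- u — v — p — q — u
  FourCycle : V → V → V → V → Set (a ⊔ ℓ)
  FourCycle u v p q = E v p × E p q × E u q × p ≢ u × q ≢ v

  InTwoFourCycles : V → V → Set (a ⊔ ℓ)
  InTwoFourCycles u v =
    ∃[ p ] ∃[ q ] ∃[ p' ] ∃[ q' ] (FourCycle u v p q × FourCycle u v p' q' × p ≢ p')

module _ {a b ℓ₁ ℓ₂} {A : Set a} {B : Set b} {E : Rel A ℓ₁} {F : Rel B ℓ₂} (φ : E ≅ F) where

  open _≅_ φ

  IsArcTransitive-transport : IsArcTransitive F → IsArcTransitive E
  IsArcTransitive-transport F-arcTransitive u v u' v' e e'
    with F-arcTransitive (to u) (to v) (to u') (to v') (map e) (map e')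
  ... | σ , σu≡u' , σv≡v' = ≅-trans φ (≅-trans σ (≅-sym φ)) , pull-back σu≡u' , pull-back σv≡v'
    where
    pull-back : ∀ {w w'} → _≅_.to σ (to w) ≡ to w' → from (_≅_.to σ (to w)) ≡ w'
    pull-back {w' = w'} eq = trans (cong from eq) (strictlyInverseʳ w')

  InTwoFourCycles-transport : ∀ {u v} → FourCycles.InTwoFourCycles E u v →
                              FourCycles.InTwoFourCycles F (to u) (to v)
  InTwoFourCycles-transport (p , q , p' , q' , C , C' , p≢p') =
    to p , to q , to p' , to q' , image C , image C' , p≢p' ∘ to-injective
    where
    image : ∀ {u v p q} → FourCycles.FourCycle E u v p q →
            FourCycles.FourCycle F (to u) (to v) (to p) (to q)
    image (vp , pq , uq , p≢u , q≢v) =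
      map vp , map pq , map uq , p≢u ∘ to-injective , q≢v ∘ to-injective

-- The cube

Q₂ : Set
Q₂ = Bool × Bool

Q₃ : Set
Q₃ = Q₂ × Bool

data RimAxis : Set where
  first second : RimAxis

data Axis : Set where
  rimAxis   : RimAxis → Axis
  layerAxis : Axis

flipRim : RimAxis → Q₂ → Q₂
flipRim first  (x , y) = (not x , y)
flipRim second (x , y) = (x , not y)

flip : Axis → Q₃ → Q₃
flip (rimAxis k) (p , z) = (flipRim k p , z)
flip layerAxis   (p , z) = (p , not z)

flipRim-first≢second : ∀ p → flipRim first p ≢ flipRim second p
flipRim-first≢second (x , _) eq = not-¬ refl (sym (cong proj₁ eq))

Q₂-Adj : Rel Q₂ 0ℓ
Q₂-Adj p p' = ∃[ k ] p' ≡ flipRim k p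

Q₃-Adj : Rel Q₃ 0ℓ
Q₃-Adj w w' = ∃[ k ] w' ≡ flip k w

origin : Q₃
origin = ((false , false) , false)

_⊕_ : Q₃ → Q₃ → Q₃
((x , y) , z) ⊕ ((x' , y') , z') = ((x xor x' , y xor y') , z xor z')

xor-cancelʳ : ∀ x y → (x xor y) xor y ≡ x
xor-cancelʳ x y = trans (xor-assoc x y y) (trans (cong (x xor_) (xor-same y)) (xor-identityʳ x))

⊕-cancelʳ : ∀ w u → (w ⊕ u) ⊕ u ≡ w
⊕-cancelʳ ((x , y) , z) ((x' , y') , z') =
  cong₂ _,_ (cong₂ _,_ (xor-cancelʳ x x') (xor-cancelʳ y y')) (xor-cancelʳ z z')

⊕-self : ∀ u → u ⊕ u ≡ origin
⊕-self ((x , y) , z) = cong₂ _,_ (cong₂ _,_ (xor-same x) (xor-same y)) (xor-same z)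

flip-⊕ : ∀ k w u → flip k w ⊕ u ≡ flip k (w ⊕ u)
flip-⊕ (rimAxis first)  ((x , _) , _) ((x' , _) , _) =
  cong (λ t → ((t , _) , _)) (sym (not-distribˡ-xor x x'))
flip-⊕ (rimAxis second) ((_ , y) , _) ((_ , y') , _) =
  cong (λ t → ((_ , t) , _)) (sym (not-distribˡ-xor y y'))
flip-⊕ layerAxis        (_ , z)       (_ , z')       =
  cong (λ t → (_ , t)) (sym (not-distribˡ-xor z z'))

reorient : Axis → Q₃ → Q₃
reorient (rimAxis first)  w             = w
reorient (rimAxis second) ((x , y) , z) = ((y , x) , z)
reorient layerAxis        ((x , y) , z) = ((z , y) , x)

transposeFirst : Axis → Axis → Axis
transposeFirst (rimAxis first)  j                = j
transposeFirst k                (rimAxis first)  = k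
transposeFirst (rimAxis second) (rimAxis second) = rimAxis first
transposeFirst (rimAxis second) layerAxis        = layerAxis
transposeFirst layerAxis        (rimAxis second) = rimAxis second
transposeFirst layerAxis        layerAxis        = rimAxis first

reorient-involutive : ∀ k w → reorient k (reorient k w) ≡ w
reorient-involutive (rimAxis first)  w = refl
reorient-involutive (rimAxis second) w = refl
reorient-involutive layerAxis        w = refl

reorient-flip : ∀ k j w → reorient k (flip j w) ≡ flip (transposeFirst k j) (reorient k w)
reorient-flip (rimAxis first)  j                w = refl
reorient-flip (rimAxis second) (rimAxis first)  w = refl
reorient-flip (rimAxis second) (rimAxis second) w = refl
reorient-flip (rimAxis second) layerAxis        w = refl
reorient-flip layerAxis        (rimAxis first)  w = refl
reorient-flip layerAxis        (rimAxis second) w = refl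
reorient-flip layerAxis        layerAxis        w = refl

reorient-origin : ∀ k → reorient k origin ≡ origin
reorient-origin (rimAxis first)  = refl
reorient-origin (rimAxis second) = refl
reorient-origin layerAxis        = refl

reorient-unit : ∀ k → reorient k (flip k origin) ≡ flip (rimAxis first) origin
reorient-unit (rimAxis first)  = refl
reorient-unit (rimAxis second) = refl
reorient-unit layerAxis        = refl

involution-≅ : (f : Q₃ → Q₃) (π : Axis → Axis) → (∀ w → f (f w) ≡ w) →
               (∀ j w → f (flip j w) ≡ flip (π j) (f w)) → Q₃-Adj ≅ Q₃-Adj
involution-≅ f π f∘f f-flip = mk≅ f f f∘f f∘f f-map f-map
  where
  f-map : ∀ {w w'} → Q₃-Adj w w' → Q₃-Adj (f w) (f w')
  f-map {w} (j , refl) = π j , f-flip j w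

translate : Q₃ → Q₃-Adj ≅ Q₃-Adj
translate u = involution-≅ (_⊕ u) id (λ w → ⊕-cancelʳ w u) (λ j w → flip-⊕ j w u)

reorientation : Axis → Q₃-Adj ≅ Q₃-Adj
reorientation k =
  involution-≅ (reorient k) (transposeFirst k) (reorient-involutive k) (reorient-flip k)

Q₃-arcTransitive : IsArcTransitive Q₃-Adj
Q₃-arcTransitive u _ u' _ (k , refl) (k' , refl) =
  ≅-trans (translate u) (≅-trans (reorientation k) (≅-trans (reorientation k') (translate u'))) ,
  u↦u' , v↦v'
  where
  open ≡-Reasoning
  u↦u' : reorient k' (reorient k (u ⊕ u)) ⊕ u' ≡ u'
  u↦u' = begin
    reorient k' (reorient k (u ⊕ u)) ⊕ u'
      ≡⟨ cong (λ t → reorient k' (reorient k t) ⊕ u') (⊕-self u) ⟩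
    reorient k' (reorient k origin) ⊕ u'
      ≡⟨ cong (λ t → reorient k' t ⊕ u') (reorient-origin k) ⟩
    reorient k' origin ⊕ u'
      ≡⟨ cong (_⊕ u') (reorient-origin k') ⟩
    u'
      ∎
  v↦v' : reorient k' (reorient k (flip k u ⊕ u)) ⊕ u' ≡ flip k' u'
  v↦v' = begin
    reorient k' (reorient k (flip k u ⊕ u)) ⊕ u'
      ≡⟨ cong (λ t → reorient k' (reorient k t) ⊕ u') (flip-⊕ k u u) ⟩
    reorient k' (reorient k (flip k (u ⊕ u))) ⊕ u'
      ≡⟨ cong (λ t → reorient k' (reorient k (flip k t)) ⊕ u') (⊕-self u) ⟩
    reorient k' (reorient k (flip k origin)) ⊕ u'
      ≡⟨ cong (λ t → reorient k' t ⊕ u') (reorient-unit k) ⟩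
    reorient k' (flip (rimAxis first) origin) ⊕ u'
      ≡⟨ cong (λ t → reorient k' t ⊕ u') (sym (reorient-unit k')) ⟩
    reorient k' (reorient k' (flip k' origin)) ⊕ u'
      ≡⟨ cong (_⊕ u') (reorient-involutive k' (flip k' origin)) ⟩
    flip k' origin ⊕ u'
      ≡⟨ flip-⊕ k' origin u' ⟩
    flip k' u'
      ∎

module PropositionalAbelianGroup {c ℓ} (G : AbelianGroup c ℓ)
  (≈⇒≡ : ∀ x y → AbelianGroup._≈_ G x y → x ≡ y) where

  open AbelianGroup G using (Carrier; _∙_; ε; _⁻¹)
  open SC G using (pow; HasOrder)

  ≡-abelianGroup : AbelianGroup c c
  ≡-abelianGroup = record
    { isAbelianGroup = record
      { isGroup = record
        { isMonoid = record
          { isSemigroup = record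
            { isMagma = record { isEquivalence = isEquivalence ; ∙-cong = cong₂ _∙_ }
            ; assoc   = λ x y z → ≈⇒≡ _ _ (assoc x y z)
            }
          ; identity = (λ x → ≈⇒≡ _ _ (identityˡ x)) , (λ x → ≈⇒≡ _ _ (identityʳ x))
          }
        ; inverse = (λ x → ≈⇒≡ _ _ (inverseˡ x)) , (λ x → ≈⇒≡ _ _ (inverseʳ x))
        ; ⁻¹-cong = cong _⁻¹
        }
      ; comm = λ x y → ≈⇒≡ _ _ (comm x y)
      }
    }
    where open AbelianGroup G using (assoc; identityˡ; identityʳ; inverseˡ; inverseʳ; comm)

  open AbelianGroup ≡-abelianGroup public
    using (assoc; comm; identityˡ; identityʳ; inverseˡ; inverseʳ; group; commutativeSemigroup)
  open Group group public using (_//_; _\\_)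
  open AbelianGroupProperties ≡-abelianGroup public
  open CommutativeSemigroupProperties commutativeSemigroup public using (interchange)
  open ≡-Reasoning

  x//ε≡x : ∀ x → x // ε ≡ x
  x//ε≡x x = trans (cong (x ∙_) ε⁻¹≈ε) (identityʳ x)

  //-telescope : ∀ x y z → (z // y) ∙ (y // x) ≡ z // x
  //-telescope x y z = begin
    (z ∙ y ⁻¹) ∙ (y ∙ x ⁻¹) ≡⟨ assoc z (y ⁻¹) (y ∙ x ⁻¹) ⟩
    z ∙ (y ⁻¹ ∙ (y ∙ x ⁻¹)) ≡⟨ cong (z ∙_) (\\-leftDividesʳ y (x ⁻¹)) ⟩
    z ∙ x ⁻¹                 ∎

  //-translation : ∀ x y g → (y ∙ g) // (x ∙ g) ≡ y // x
  //-translation x y g = begin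
    (y ∙ g) ∙ (x ∙ g) ⁻¹       ≡⟨ cong ((y ∙ g) ∙_) (sym (⁻¹-∙-comm x g)) ⟩
    (y ∙ g) ∙ (x ⁻¹ ∙ g ⁻¹)    ≡⟨ interchange y g (x ⁻¹) (g ⁻¹) ⟩
    (y ∙ x ⁻¹) ∙ (g ∙ g ⁻¹)    ≡⟨ cong ((y ∙ x ⁻¹) ∙_) (inverseʳ g) ⟩
    (y ∙ x ⁻¹) ∙ ε             ≡⟨ identityʳ (y ∙ x ⁻¹) ⟩
    y ∙ x ⁻¹                   ∎

  pow-+ : ∀ x m n → pow x (m + n) ≡ pow x m ∙ pow x n
  pow-+ x zero    n = sym (identityˡ (pow x n))
  pow-+ x (suc m) n = trans (cong (x ∙_) (pow-+ x m n)) (sym (assoc x (pow x m) (pow x n)))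

  pow-multiple : ∀ x {n} m → pow x n ≡ ε → pow x (m * n) ≡ ε
  pow-multiple x zero    _  = refl
  pow-multiple x {n} (suc m) xⁿ≡ε = begin
    pow x (n + m * n)          ≡⟨ pow-+ x n (m * n) ⟩
    pow x n ∙ pow x (m * n)    ≡⟨ cong₂ _∙_ xⁿ≡ε (pow-multiple x m xⁿ≡ε) ⟩
    ε ∙ ε                      ≡⟨ identityˡ ε ⟩
    ε                          ∎

  pow-4 : ∀ x → pow x 4 ≡ (x ∙ x) ∙ (x ∙ x)
  pow-4 x = trans (pow-+ x 2 2) (cong₂ _∙_ x² x²)
    where
    x² : pow x 2 ≡ x ∙ x
    x² = cong (x ∙_) (identityʳ x)

  pow4≡ε⇔ : ∀ x → pow x 4 ≡ ε ⇔ x ∙ x ≡ x ⁻¹ ∙ x ⁻¹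
  pow4≡ε⇔ x = mk⇔
    (λ x⁴≡ε → trans (inverseʳ-unique (x ∙ x) (x ∙ x) (trans (sym (pow-4 x)) x⁴≡ε))
                    (sym (⁻¹-∙-comm x x)))
    (λ x²≡x⁻² → begin
      pow x 4                     ≡⟨ pow-4 x ⟩
      (x ∙ x) ∙ (x ∙ x)           ≡⟨ cong ((x ∙ x) ∙_) (trans x²≡x⁻² (⁻¹-∙-comm x x)) ⟩
      (x ∙ x) ∙ (x ∙ x) ⁻¹        ≡⟨ inverseʳ (x ∙ x) ⟩
      ε                           ∎)

  x³≡x∨x⁻¹⇒x²≡x⁻² : ∀ x → x ∙ (x ∙ x) ≡ x ⊎ x ∙ (x ∙ x) ≡ x ⁻¹ → x ∙ x ≡ x ⁻¹ ∙ x ⁻¹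
  x³≡x∨x⁻¹⇒x²≡x⁻² x (inj₁ x³≡x) = cong₂ _∙_ x≡x⁻¹ x≡x⁻¹
    where
    x≡x⁻¹ : x ≡ x ⁻¹
    x≡x⁻¹ = inverseʳ-unique x x (∙-cancelˡ x (x ∙ x) ε (trans x³≡x (sym (identityʳ x))))
  x³≡x∨x⁻¹⇒x²≡x⁻² x (inj₂ x³≡x⁻¹) = trans (sym (\\-leftDividesʳ x (x ∙ x))) (cong (x ⁻¹ ∙_) x³≡x⁻¹)

  pow4≡ε⇒order≡4 : ∀ {x k} → pow x 4 ≡ ε → x ≢ ε → HasOrder x k → 2 < k → k ≡ 4
  pow4≡ε⇒order≡4 {k = 1} _ _ _ (s≤s ())
  pow4≡ε⇒order≡4 {k = 2} _ _ _ (s≤s (s≤s ()))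
  pow4≡ε⇒order≡4 {x} {3} x⁴≡ε x≢ε (_ , x³≡ε , _) _ =
    ⊥-elim (x≢ε (trans (sym (identityʳ x)) (trans (cong (x ∙_) (sym x³≡ε)) x⁴≡ε)))
  pow4≡ε⇒order≡4 {k = 4} _ _ _ _ = refl
  pow4≡ε⇒order≡4 {k = suc (suc (suc (suc (suc _))))} x⁴≡ε _ (_ , _ , minimal) _ =
    ⊥-elim (minimal 4 (s≤s z≤n) (s≤s (s≤s (s≤s (s≤s (s≤s z≤n))))) x⁴≡ε)

  pow4≢ε⇒order : ∀ {x k} → pow x 4 ≢ ε → HasOrder x k → 2 < k × k ≢ 4
  pow4≢ε⇒order {x} {k} x⁴≢ε (0<k , xᵏ≡ε , _) = more-than-2 k 0<k xᵏ≡ε , λ { refl → x⁴≢ε xᵏ≡ε }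
    where
    more-than-2 : ∀ k → 0 < k → pow x k ≡ ε → 2 < k
    more-than-2 1 _ x¹≡ε = ⊥-elim (x⁴≢ε (pow-multiple x {1} 4 x¹≡ε))
    more-than-2 2 _ x²≡ε = ⊥-elim (x⁴≢ε (pow-multiple x {2} 2 x²≡ε))
    more-than-2 (suc (suc (suc _))) _ _ = s≤s (s≤s (s≤s z≤n))

  Translational : (Carrier → Carrier) → Carrier → Set c
  Translational f g = ∃[ h ] ∀ y → f (g ∙ y) ≡ h ∙ f y

  translational-ε : ∀ f → Translational f ε
  translational-ε f = ε , λ y → trans (cong f (identityˡ y)) (sym (identityˡ (f y)))

  translational-∙ : ∀ {f x y} → Translational f x → Translational f y → Translational f (x ∙ y)
  translational-∙ {f} {x} {y} (h , fx) (h' , fy) = h ∙ h' , λ z → begin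
    f ((x ∙ y) ∙ z)     ≡⟨ cong f (assoc x y z) ⟩
    f (x ∙ (y ∙ z))     ≡⟨ fx (y ∙ z) ⟩
    h ∙ f (y ∙ z)       ≡⟨ cong (h ∙_) (fy z) ⟩
    h ∙ (h' ∙ f z)      ≡⟨ assoc h h' (f z) ⟨
    (h ∙ h') ∙ f z      ∎

module FiniteAbelianGroup {c ℓ} (G : AbelianGroup c ℓ) (fin : IsFiniteAbelian G) where

  open AbelianGroup G using (Carrier; _∙_; ε; _⁻¹)
  open SC G using (pow; HasOrder)
  open IsFiniteAbelian fin
  open PropositionalAbelianGroup G ≈⇒≡

  index : Carrier ↣ Fin size
  index = ↔⇒↣ (↔-sym enum)

  infix 4 _≟_
  _≟_ : DecidableEquality Carrier
  _≟_ = via-injection index Fin._≟_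

  periodic : ∀ x → ∃[ n ] (0 < n × pow x n ≡ ε)
  periodic x with pigeonhole (n<1+n size) (λ i → Injection.to index (pow x (toℕ i)))
  ... | i , j , i<j , same-index =
    toℕ j ∸ toℕ i , m<n⇒0<n∸m i<j ,
    ∙-cancelʳ (pow x (toℕ i)) _ _ (begin
      pow x (toℕ j ∸ toℕ i) ∙ pow x (toℕ i)  ≡⟨ sym (pow-+ x (toℕ j ∸ toℕ i) (toℕ i)) ⟩
      pow x (toℕ j ∸ toℕ i + toℕ i)          ≡⟨ cong (pow x) (m∸n+n≡m (<⇒≤ i<j)) ⟩
      pow x (toℕ j)                          ≡⟨ Injection.injective index same-index ⟨
      pow x (toℕ i)                          ≡⟨ sym (identityˡ _) ⟩
      ε ∙ pow x (toℕ i)                      ∎)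
    where open ≡-Reasoning

  order : ∀ x → ∃[ k ] HasOrder x k
  order x with least-witness (λ n → (0 <? n) ×-dec (pow x n ≟ ε)) (proj₂ (periodic x))
  ... | k , (0<k , xᵏ≡ε) , minimal = k , 0<k , xᵏ≡ε , λ j 0<j j<k xʲ≡ε → minimal j<k (0<j , xʲ≡ε)

module SCGraph {c ℓ} (G : AbelianGroup c ℓ)
  (≈⇒≡ : ∀ x y → AbelianGroup._≈_ G x y → x ≡ y) (R : Pred (AbelianGroup.Carrier G) c) where

  open AbelianGroup G using (Carrier; _∙_; ε; _⁻¹)
  open SC G
  open Graph R R
  open PropositionalAbelianGroup G ≈⇒≡

  other : Fin 2 → Fin 2
  other 0F = 1F
  other 1F = 0F

  other-involutive : ∀ i → other (other i) ≡ i
  other-involutive 0F = refl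
  other-involutive 1F = refl

  ≢⇒≡other : ∀ {i j} → i ≢ j → j ≡ other i
  ≢⇒≡other {0F} {0F} i≢j = ⊥-elim (i≢j refl)
  ≢⇒≡other {0F} {1F} _   = refl
  ≢⇒≡other {1F} {0F} _   = refl
  ≢⇒≡other {1F} {1F} i≢j = ⊥-elim (i≢j refl)

  RimAdj : Rel Carrier c
  RimAdj x y = R (y // x)

  R-step : ∀ {c} x → R c → RimAdj x (c ∙ x)
  R-step {c} x = subst R (sym (//-rightDividesʳ x c))

  data Link : Vertex → Vertex → Set c where
    rim   : ∀ {x y} i → RimAdj x y → Link (x , i) (y , i)
    spoke : ∀ {x i j} → i ≢ j → Link (x , i) (x , j)

  link : ∀ {u v} → E u v → Link u v
  link (edge₁ r) = rim 0F r
  link (edge₂ r) = rim 1F r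
  link spoke₁₂   = spoke λ ()
  link spoke₂₁   = spoke λ ()

  unlink : ∀ {u v} → Link u v → E u v
  unlink (rim 0F r) = edge₁ r
  unlink (rim 1F r) = edge₂ r
  unlink (spoke {i = 0F} {0F} i≢j) = ⊥-elim (i≢j refl)
  unlink (spoke {i = 0F} {1F} _)   = spoke₁₂
  unlink (spoke {i = 1F} {0F} _)   = spoke₂₁
  unlink (spoke {i = 1F} {1F} i≢j) = ⊥-elim (i≢j refl)

  rim-step : ∀ {c} x i → R c → E (x , i) (c ∙ x , i)
  rim-step x i r = unlink (rim i (R-step x r))

  toAut : E ≅ E → Aut
  toAut σ = record { perm = _≅_.bijection σ ; preserves = _≅_.preserves σ }

  fromAut : Aut → E ≅ E
  fromAut σ = record { bijection = Aut.perm σ ; preserves = Aut.preserves σ }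

  isArcTransitive⇒arcTransitive : IsArcTransitive E → ArcTransitive
  isArcTransitive⇒arcTransitive arcTransitive u v u' v' e e' with arcTransitive u v u' v' e e'
  ... | σ , σu≡u' , σv≡v' = toAut σ , σu≡u' , σv≡v'

  translation : Carrier → E ≅ E
  translation g = mk≅ (ρ g) (ρ (g ⁻¹))
    (λ (x , i) → cong (_, i) (//-rightDividesˡ g x))
    (λ (x , i) → cong (_, i) (//-rightDividesʳ g x))
    (unlink ∘ translate-link ∘ link) (unlink ∘ translate-link ∘ link)
    where
    translate-link : ∀ {h u v} → Link u v → Link (ρ h u) (ρ h v)
    translate-link {h} (rim {x} {y} i r) = rim i (subst R (sym (//-translation x y h)) r)
    translate-link (spoke i≢j)           = spoke i≢j

  layerSwap : E ≅ E
  layerSwap = mk≅ swap swap involutive involutive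
    (unlink ∘ swap-link ∘ link) (unlink ∘ swap-link ∘ link)
    where
    swap : Vertex → Vertex
    swap (x , i) = (x , other i)
    involutive : ∀ v → swap (swap v) ≡ v
    involutive (x , i) = cong (x ,_) (other-involutive i)
    swap-link : ∀ {u v} → Link u v → Link (swap u) (swap v)
    swap-link (rim i r)               = rim (other i) r
    swap-link (spoke {i = i} {j} i≢j) = spoke λ eq →
      i≢j (trans (sym (other-involutive i)) (trans (cong other eq) (other-involutive j)))

  vertexTransitive : VertexTransitive
  vertexTransitive (x , i) (y , j) with i Fin.≟ j
  ... | yes refl = toAut (translation (x \\ y)) , cong (_, i) (\\-leftDividesˡ x y)
  ... | no  i≢j  = toAut (≅-trans (translation (x \\ y)) layerSwap) ,
                   cong₂ _,_ (\\-leftDividesˡ x y) (sym (≢⇒≡other i≢j))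

  -- conjugating ρ a by an automorphism that turns the arc (ε , 0) → (a , 0) into a spoke
  -- gives a map that changes the layer of (ε , 0)
  arcTransitive⇒¬normal : ∀ {a} → R a → ArcTransitive → ¬ Normal
  arcTransitive⇒¬normal {a} Ra arcTransitive normal
    with arcTransitive (ε , 0F) (a ∙ ε , 0F) (ε , 0F) (ε , 1F) (rim-step ε 0F Ra) spoke₁₂
  ... | σ , σu≡u' , σv≡v' with normal σ a
  ... | h , conjugate = 1F≢0F (cong proj₂ (trans (sym conjugate-at-ε) (conjugate (ε , 0F))))
    where
    open Aut σ
    1F≢0F : 1F ≢ 0F
    1F≢0F ()
    conjugate-at-ε : to (ρ a (from (ε , 0F))) ≡ (ε , 1F)
    conjugate-at-ε = begin
      to (ρ a (from (ε , 0F)))   ≡⟨ cong (to ∘ ρ a ∘ from) σu≡u' ⟨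
      to (ρ a (from (to (ε , 0F)))) ≡⟨ cong (to ∘ ρ a) (strictlyInverseʳ _) ⟩
      to (ε ∙ a , 0F)            ≡⟨ cong (λ x → to (x , 0F)) (comm ε a) ⟩
      to (a ∙ ε , 0F)            ≡⟨ σv≡v' ⟩
      (ε , 1F)                   ∎
      where open ≡-Reasoning

  generated : Connected → ∀ {p} (P : Pred Carrier p) → P ε →
              (∀ {c x} → R c → P x → P (c ∙ x)) → ∀ x → P x
  generated connected P Pε step x = along (connected (ε , 0F) (x , 0F)) Pε
    where
    across : ∀ {u v} → Link u v → P (proj₁ u) → P (proj₁ v)
    across (rim {x} {y} _ r) Px = subst P (//-rightDividesˡ x y) (step r Px)
    across (spoke _)         Px = Px
    along : ∀ {u v} → Star E u v → P (proj₁ u) → P (proj₁ v)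
    along ε★         Pu = Pu
    along (e ◅ path) Pu = along path (across (link e) Pu)

  Condition₃ : Set c
  Condition₃ = ∃[ a ] ∃[ k ] ((∀ x → R x ⇔ (x ≡ a ⊎ x ≡ a ⁻¹)) × HasOrder a k × 2 < k × k ≢ 4)

  rim≅Q₂⇒≅Q₃ : RimAdj ≅ Q₂-Adj → E ≅ Q₃-Adj
  rim≅Q₂⇒≅Q₃ φ = mk≅ to′ from′ to′∘from′ from′∘to′ (to′-map ∘ link) from′-map
    where
    open _≅_ φ
    module L = Inverse 2↔Bool
    to′ : Vertex → Q₃
    to′ (x , i) = (to x , L.to i)
    from′ : Q₃ → Vertex
    from′ (p , z) = (from p , L.from z)
    to′∘from′ : ∀ w → to′ (from′ w) ≡ w
    to′∘from′ (p , z) = cong₂ _,_ (strictlyInverseˡ p) (L.strictlyInverseˡ z)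
    from′∘to′ : ∀ v → from′ (to′ v) ≡ v
    from′∘to′ (x , i) = cong₂ _,_ (strictlyInverseʳ x) (L.strictlyInverseʳ i)
    layer-≢ : ∀ {i j} → i ≢ j → L.to j ≡ not (L.to i)
    layer-≢ {i} i≢j = trans (cong L.to (≢⇒≡other i≢j)) (to-other i)
      where
      to-other : ∀ i → L.to (other i) ≡ not (L.to i)
      to-other 0F = refl
      to-other 1F = refl
    to′-map : ∀ {u v} → Link u v → Q₃-Adj (to′ u) (to′ v)
    to′-map (rim i r) with map r
    ... | k , eq = rimAxis k , cong (_, L.to i) eq
    to′-map (spoke {x = x} i≢j) = layerAxis , cong (to x ,_) (layer-≢ i≢j)
    from′-map : ∀ {w w'} → Q₃-Adj w w' → E (from′ w) (from′ w')
    from′-map {p , z} (rimAxis k , refl) = unlink (rim _ (_≅_.map (≅-sym φ) (k , refl)))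
    from′-map {p , z} (layerAxis , refl) = unlink (spoke (z≢not-z z))
      where
      z≢not-z : ∀ z → L.from z ≢ L.from (not z)
      z≢not-z false ()
      z≢not-z true  ()

  -- R = {a , b} with a² = b²: the cube

  module CubeCase (connected : Connected) {a b}
    (R⇔ : ∀ x → R x ⇔ (x ≡ a ⊎ x ≡ b)) (a≢b : a ≢ b) (ε∉R : ¬ R ε)
    (R⁻¹ : ∀ x → R x → R (x ⁻¹)) (a²≡b² : a ∙ a ≡ b ∙ b) where

    Ra : R a
    Ra = Equivalence.from (R⇔ a) (inj₁ refl)

    Rb : R b
    Rb = Equivalence.from (R⇔ b) (inj₂ refl)

    R-exhausted : ∀ {x y z} → R x → R y → x ≢ y → R z → z ≡ x ⊎ z ≡ y
    R-exhausted Rx Ry x≢y Rz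
      with Equivalence.to (R⇔ _) Rx | Equivalence.to (R⇔ _) Ry | Equivalence.to (R⇔ _) Rz
    ... | inj₁ refl | inj₁ refl | _         = ⊥-elim (x≢y refl)
    ... | inj₂ refl | inj₂ refl | _         = ⊥-elim (x≢y refl)
    ... | inj₁ refl | inj₂ refl | inj₁ refl = inj₁ refl
    ... | inj₁ refl | inj₂ refl | inj₂ refl = inj₂ refl
    ... | inj₂ refl | inj₁ refl | inj₁ refl = inj₂ refl
    ... | inj₂ refl | inj₁ refl | inj₂ refl = inj₁ refl

    RimAdj-sym : ∀ {x y} → RimAdj x y → RimAdj y x
    RimAdj-sym {x} {y} r = subst R (⁻¹-anti-homo-// y x) (R⁻¹ _ r)

    -- the rim Cay(G,R) is the 4-cycle ε — a — a // b — b — ε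
    label : Q₂ → Carrier
    label (false , false) = ε
    label (true  , false) = a
    label (false , true)  = b
    label (true  , true)  = a // b

    b//[a//b]≡a : b // (a // b) ≡ a
    b//[a//b]≡a = begin
      b ∙ (a // b) ⁻¹    ≡⟨ cong (b ∙_) (⁻¹-anti-homo-// a b) ⟩
      b ∙ (b ∙ a ⁻¹)     ≡⟨ assoc b b (a ⁻¹) ⟨
      (b ∙ b) ∙ a ⁻¹     ≡⟨ cong (_∙ a ⁻¹) a²≡b² ⟨
      (a ∙ a) ∙ a ⁻¹     ≡⟨ //-rightDividesʳ a a ⟩
      a                  ∎
      where open ≡-Reasoning

    a//[a//b]≡b : a // (a // b) ≡ b
    a//[a//b]≡b = begin
      a ∙ (a // b) ⁻¹    ≡⟨ cong (a ∙_) (⁻¹-anti-homo-// a b) ⟩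
      a ∙ (b ∙ a ⁻¹)     ≡⟨ comm a (b ∙ a ⁻¹) ⟩
      (b ∙ a ⁻¹) ∙ a     ≡⟨ //-rightDividesˡ a b ⟩
      b                  ∎
      where open ≡-Reasoning

    label-adjacent : ∀ k p → RimAdj (label p) (label (flipRim k p))
    label-adjacent first  (false , false) = subst R (sym (x//ε≡x a)) Ra
    label-adjacent second (false , false) = subst R (sym (x//ε≡x b)) Rb
    label-adjacent first  (true  , true)  = subst R (sym b//[a//b]≡a) Ra
    label-adjacent second (true  , true)  = subst R (sym a//[a//b]≡b) Rb
    label-adjacent first  (true  , false) = RimAdj-sym (label-adjacent first (false , false))
    label-adjacent second (true  , false) = RimAdj-sym (label-adjacent second (true , true))
    label-adjacent first  (false , true)  = RimAdj-sym (label-adjacent first (true , true))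
    label-adjacent second (false , true)  = RimAdj-sym (label-adjacent second (false , false))

    label-flip≢ : ∀ k p → label (flipRim k p) ≢ label p
    label-flip≢ k p eq =
      ε∉R (subst R (trans (cong (_// label p) eq) (inverseʳ (label p))) (label-adjacent k p))

    a//b≢ε : a // b ≢ ε
    a//b≢ε = a≢b ∘ x∙y⁻¹≈ε⇒x≈y a b

    label-injective : ∀ {p p'} → label p ≡ label p' → p ≡ p'
    label-injective {false , false} {false , false} = λ _ → refl
    label-injective {false , false} {true , false}  = ⊥-elim ∘ label-flip≢ first (false , false) ∘ sym
    label-injective {false , false} {false , true}  = ⊥-elim ∘ label-flip≢ second (false , false) ∘ sym
    label-injective {false , false} {true , true}   = ⊥-elim ∘ a//b≢ε ∘ sym
    label-injective {true , false}  {false , false} = ⊥-elim ∘ label-flip≢ first (false , false)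
    label-injective {true , false}  {true , false}  = λ _ → refl
    label-injective {true , false}  {false , true}  = ⊥-elim ∘ a≢b
    label-injective {true , false}  {true , true}   = ⊥-elim ∘ label-flip≢ second (true , false) ∘ sym
    label-injective {false , true}  {false , false} = ⊥-elim ∘ label-flip≢ second (false , false)
    label-injective {false , true}  {true , false}  = ⊥-elim ∘ a≢b ∘ sym
    label-injective {false , true}  {false , true}  = λ _ → refl
    label-injective {false , true}  {true , true}   = ⊥-elim ∘ label-flip≢ first (false , true) ∘ sym
    label-injective {true , true}   {false , false} = ⊥-elim ∘ a//b≢ε
    label-injective {true , true}   {true , false}  = ⊥-elim ∘ label-flip≢ second (true , false)
    label-injective {true , true}   {false , true}  = ⊥-elim ∘ label-flip≢ first (false , true)
    label-injective {true , true}   {true , true}   = λ _ → refl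

    steps-distinct : ∀ p → label (flipRim first p) // label p ≢ label (flipRim second p) // label p
    steps-distinct p = flipRim-first≢second p ∘ label-injective ∘ ∙-cancelʳ _ _ _

    rim-neighbour : ∀ {c} p → R c → ∃[ k ] c ∙ label p ≡ label (flipRim k p)
    rim-neighbour p Rc
      with R-exhausted (label-adjacent first p) (label-adjacent second p) (steps-distinct p) Rc
    ... | inj₁ refl = first  , //-rightDividesˡ (label p) (label (flipRim first p))
    ... | inj₂ refl = second , //-rightDividesˡ (label p) (label (flipRim second p))

    labelled : ∀ x → ∃[ p ] label p ≡ x
    labelled = generated connected _ ((false , false) , refl) step
      where
      step : ∀ {c x} → R c → ∃[ p ] label p ≡ x → ∃[ p ] label p ≡ c ∙ x
      step Rc (p , refl) with rim-neighbour p Rc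
      ... | k , eq = flipRim k p , sym eq

    code : Carrier → Q₂
    code x = proj₁ (labelled x)

    label∘code : ∀ x → label (code x) ≡ x
    label∘code x = proj₂ (labelled x)

    rim≅Q₂ : RimAdj ≅ Q₂-Adj
    rim≅Q₂ = mk≅ code label (λ p → label-injective (label∘code (label p))) label∘code
      to-map (λ { (k , refl) → label-adjacent k _ })
      where
      to-map : ∀ {x y} → RimAdj x y → Q₂-Adj (code x) (code y)
      to-map {x} {y} r with rim-neighbour (code x) r
      ... | k , eq = k , label-injective (begin
        label (code y)                   ≡⟨ label∘code y ⟩
        y                                ≡⟨ //-rightDividesˡ x y ⟨
        (y // x) ∙ x                     ≡⟨ cong ((y // x) ∙_) (label∘code x) ⟨
        (y // x) ∙ label (code x)        ≡⟨ eq ⟩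
        label (flipRim k (code x))       ∎)
        where open ≡-Reasoning

    arcTransitive : ArcTransitive
    arcTransitive = isArcTransitive⇒arcTransitive
      (IsArcTransitive-transport (rim≅Q₂⇒≅Q₃ rim≅Q₂) Q₃-arcTransitive)

    R-pow4≡ε : ∀ {x} → R x → pow x 4 ≡ ε
    R-pow4≡ε {x} Rx = Equivalence.from (pow4≡ε⇔ x)
      (square≡ (Equivalence.to (R⇔ x) Rx) (Equivalence.to (R⇔ (x ⁻¹)) (R⁻¹ x Rx)))
      where
      square≡ : x ≡ a ⊎ x ≡ b → x ⁻¹ ≡ a ⊎ x ⁻¹ ≡ b → x ∙ x ≡ x ⁻¹ ∙ x ⁻¹
      square≡ (inj₁ refl) (inj₁ x⁻¹≡a) = cong₂ _∙_ (sym x⁻¹≡a) (sym x⁻¹≡a)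
      square≡ (inj₁ refl) (inj₂ x⁻¹≡b) = trans a²≡b² (cong₂ _∙_ (sym x⁻¹≡b) (sym x⁻¹≡b))
      square≡ (inj₂ refl) (inj₁ x⁻¹≡a) = trans (sym a²≡b²) (cong₂ _∙_ (sym x⁻¹≡a) (sym x⁻¹≡a))
      square≡ (inj₂ refl) (inj₂ x⁻¹≡b) = cong₂ _∙_ (sym x⁻¹≡b) (sym x⁻¹≡b)

    ¬condition₃ : ¬ Condition₃
    ¬condition₃ (a' , k , R⇔′ , hasOrder , 2<k , k≢4) =
      k≢4 (pow4≡ε⇒order≡4 (R-pow4≡ε Ra') (λ a'≡ε → ε∉R (subst R a'≡ε Ra')) hasOrder 2<k)
      where
      Ra' : R a'
      Ra' = Equivalence.from (R⇔′ a') (inj₁ refl)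

  -- R = {a , a⁻¹} with a² ≠ a⁻²: a prism other than the cube

  module PrismCase (connected : Connected) {a}
    (R⇔ : ∀ x → R x ⇔ (x ≡ a ⊎ x ≡ a ⁻¹)) (a²≢a⁻² : a ∙ a ≢ a ⁻¹ ∙ a ⁻¹) where

    open FourCycles E

    Ra : R a
    Ra = Equivalence.from (R⇔ a) (inj₁ refl)

    Ra⁻¹ : R (a ⁻¹)
    Ra⁻¹ = Equivalence.from (R⇔ (a ⁻¹)) (inj₂ refl)

    a≢a⁻¹ : a ≢ a ⁻¹
    a≢a⁻¹ eq = a²≢a⁻² (cong₂ _∙_ eq eq)

    a∙a≢ε : a ∙ a ≢ ε
    a∙a≢ε = a≢a⁻¹ ∘ inverseʳ-unique a a

    R-square≢ : ∀ {c} → R c → c ∙ c ≢ c ⁻¹ ∙ c ⁻¹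
    R-square≢ {c} Rc with Equivalence.to (R⇔ c) Rc
    ... | inj₁ refl = a²≢a⁻²
    ... | inj₂ refl = λ eq → a²≢a⁻² (sym (trans eq (cong₂ _∙_ (⁻¹-involutive a) (⁻¹-involutive a))))

    same-or-inverse : ∀ {c d} → R c → R d → d ≡ c ⊎ d ≡ c ⁻¹
    same-or-inverse Rc Rd with Equivalence.to (R⇔ _) Rc | Equivalence.to (R⇔ _) Rd
    ... | inj₁ refl | inj₁ refl = inj₁ refl
    ... | inj₁ refl | inj₂ refl = inj₂ refl
    ... | inj₂ refl | inj₁ refl = inj₂ (sym (⁻¹-involutive a))
    ... | inj₂ refl | inj₂ refl = inj₁ refl

    no-backtracking : ∀ {x y z} → RimAdj x y → RimAdj y z → z ≢ x → z // y ≡ y // x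
    no-backtracking {x} {y} {z} r r' z≢x with same-or-inverse r r'
    ... | inj₁ same    = same
    ... | inj₂ inverse = ⊥-elim (z≢x (x∙y⁻¹≈ε⇒x≈y z x (begin
      z // x                     ≡⟨ //-telescope x y z ⟨
      (z // y) ∙ (y // x)        ≡⟨ cong (_∙ (y // x)) inverse ⟩
      (y // x) ⁻¹ ∙ (y // x)     ≡⟨ inverseˡ (y // x) ⟩
      ε                          ∎)))
      where open ≡-Reasoning

    -- the three steps of a non-backtracking walk x, y, z, w agree, so w // x = s³ ∈ {s , s⁻¹},
    -- forcing s² = s⁻²
    no-rim-fourCycle : ∀ {x y z w} → RimAdj x y → RimAdj y z → RimAdj z w → RimAdj x w →
                       z ≢ x → w ≢ y → ⊥
    no-rim-fourCycle {x} {y} {z} {w} r₁ r₂ r₃ r₄ z≢x w≢y =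
      R-square≢ r₁ (x³≡x∨x⁻¹⇒x²≡x⁻² s (same-or-inverse r₁ (subst R w//x≡s³ r₄)))
      where
      s : Carrier
      s = y // x
      s₂≡s : z // y ≡ s
      s₂≡s = no-backtracking r₁ r₂ z≢x
      s₃≡s : w // z ≡ s
      s₃≡s = trans (no-backtracking r₂ r₃ w≢y) s₂≡s
      w//x≡s³ : w // x ≡ s ∙ (s ∙ s)
      w//x≡s³ = begin
        w // x                        ≡⟨ //-telescope x z w ⟨
        (w // z) ∙ (z // x)           ≡⟨ cong ((w // z) ∙_) (//-telescope x y z) ⟨
        (w // z) ∙ ((z // y) ∙ s)     ≡⟨ cong₂ (λ u v → u ∙ (v ∙ s)) s₃≡s s₂≡s ⟩
        s ∙ (s ∙ s)                   ∎
        where open ≡-Reasoning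

    rim-fourCycle : ∀ {x y i p q} → RimAdj x y → FourCycle (x , i) (y , i) p q → p ≡ (y , other i)
    rim-fourCycle r (vp , pq , uq , p≢u , q≢v) with link vp
    ... | spoke i≢j = cong (_ ,_) (≢⇒≡other i≢j)
    ... | rim _ r₂ with link pq | link uq
    ...   | spoke i≢j | rim _ _  = ⊥-elim (i≢j refl)
    ...   | spoke _   | spoke _  = ⊥-elim (p≢u refl)
    ...   | rim _ r₃  | rim _ r₄ =
      ⊥-elim (no-rim-fourCycle r r₂ r₃ r₄ (p≢u ∘ cong (_, _)) (q≢v ∘ cong (_, _)))
    ...   | rim _ _   | spoke i≢i = ⊥-elim (i≢i refl)

    rim-notInTwo : ∀ {x y i} → RimAdj x y → ¬ InTwoFourCycles (x , i) (y , i)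
    rim-notInTwo r (_ , _ , _ , _ , C , C' , p≢p') =
      p≢p' (trans (rim-fourCycle r C) (sym (rim-fourCycle r C')))

    spoke-inTwo : ∀ {x i j} → i ≢ j → InTwoFourCycles (x , i) (x , j)
    spoke-inTwo {x} {i} {j} i≢j =
      _ , _ , _ , _ , fourCycle Ra , fourCycle Ra⁻¹ , a≢a⁻¹ ∘ ∙-cancelʳ x a (a ⁻¹) ∘ cong proj₁
      where
      fourCycle : ∀ {c} → R c → FourCycle (x , i) (x , j) (c ∙ x , j) (c ∙ x , i)
      fourCycle Rc = rim-step x j Rc , unlink (spoke (i≢j ∘ sym)) , rim-step x i Rc ,
                     i≢j ∘ sym ∘ cong proj₂ , i≢j ∘ cong proj₂

    inTwo⇒spoke : ∀ {u v} → E u v → InTwoFourCycles u v → proj₁ u ≡ proj₁ v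
    inTwo⇒spoke e two with link e
    ... | rim _ r = ⊥-elim (rim-notInTwo r two)
    ... | spoke _ = refl

    notInTwo⇒rim : ∀ {u v} → E u v → ¬ InTwoFourCycles u v →
                   proj₂ u ≡ proj₂ v × RimAdj (proj₁ u) (proj₁ v)
    notInTwo⇒rim e ¬two with link e
    ... | rim _ r     = refl , r
    ... | spoke i≢j = ⊥-elim (¬two (spoke-inTwo i≢j))

    ¬arcTransitive : ¬ ArcTransitive
    ¬arcTransitive arcTransitive
      with arcTransitive (ε , 0F) (ε , 1F) (ε , 0F) (a ∙ ε , 0F) spoke₁₂ (rim-step ε 0F Ra)
    ... | σ , σu≡u' , σv≡v' = rim-notInTwo (R-step ε Ra) (subst₂ InTwoFourCycles σu≡u' σv≡v'
      (InTwoFourCycles-transport (fromAut σ) (spoke-inTwo λ ())))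

    -- δ x ∈ R is the step of f along the edge x — a ∙ x; by injectivity of f consecutive steps
    -- never cancel, so δ is constant
    module RimAutomorphism (f : Carrier → Carrier) (f-injective : ∀ {x y} → f x ≡ f y → x ≡ y)
      (f-rim : ∀ {c} x → R c → RimAdj (f x) (f (c ∙ x))) where

      δ : Carrier → Carrier
      δ x = f (a ∙ x) // f x

      δ-invariant : ∀ x → δ (a ∙ x) ≡ δ x
      δ-invariant x = no-backtracking (f-rim x Ra) (f-rim (a ∙ x) Ra) (a∙a≢ε ∘ a∙a≡ε ∘ f-injective)
        where
        a∙a≡ε : a ∙ (a ∙ x) ≡ x → a ∙ a ≡ ε
        a∙a≡ε eq = ∙-cancelʳ x _ _ (trans (assoc a a x) (trans eq (sym (identityˡ x))))

      δ-constant : ∀ x → δ x ≡ δ ε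
      δ-constant = generated connected _ refl step
        where
        step : ∀ {c x} → R c → δ x ≡ δ ε → δ (c ∙ x) ≡ δ ε
        step {c} {x} Rc δx≡δε with Equivalence.to (R⇔ c) Rc
        ... | inj₁ refl = trans (δ-invariant x) δx≡δε
        ... | inj₂ refl =
          trans (sym (δ-invariant (a ⁻¹ ∙ x))) (trans (cong δ (\\-leftDividesˡ a x)) δx≡δε)

      f-a : ∀ y → f (a ∙ y) ≡ δ ε ∙ f y
      f-a y = trans (sym (//-rightDividesˡ (f y) (f (a ∙ y)))) (cong (_∙ f y) (δ-constant y))

      translational-R : ∀ {c} → R c → Translational f c
      translational-R {c} Rc with Equivalence.to (R⇔ c) Rc
      ... | inj₁ refl = δ ε , f-a
      ... | inj₂ refl = δ ε ⁻¹ , λ y → begin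
        f (a ⁻¹ ∙ y)                          ≡⟨ \\-leftDividesʳ (δ ε) _ ⟨
        δ ε ⁻¹ ∙ (δ ε ∙ f (a ⁻¹ ∙ y))         ≡⟨ cong (δ ε ⁻¹ ∙_) (f-a (a ⁻¹ ∙ y)) ⟨
        δ ε ⁻¹ ∙ f (a ∙ (a ⁻¹ ∙ y))           ≡⟨ cong (λ t → δ ε ⁻¹ ∙ f t) (\\-leftDividesˡ a y) ⟩
        δ ε ⁻¹ ∙ f y                          ∎
        where open ≡-Reasoning

      translational : ∀ g → Translational f g
      translational = generated connected _ (translational-ε f) (translational-∙ ∘ translational-R)

    module Automorphism (σ : Aut) where

      open _≅_ (fromAut σ)

      inTwo-preserved : ∀ {u v} → InTwoFourCycles u v → InTwoFourCycles (to u) (to v)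
      inTwo-preserved = InTwoFourCycles-transport (fromAut σ)

      inTwo-reflected : ∀ {u v} → InTwoFourCycles (to u) (to v) → InTwoFourCycles u v
      inTwo-reflected two = subst₂ InTwoFourCycles (strictlyInverseʳ _) (strictlyInverseʳ _)
        (InTwoFourCycles-transport (≅-sym (fromAut σ)) two)

      spoke-image : ∀ x → proj₁ (to (x , 0F)) ≡ proj₁ (to (x , 1F))
      spoke-image x = inTwo⇒spoke (map spoke₁₂) (inTwo-preserved (spoke-inTwo λ ()))

      rim-image : ∀ {c} x i → R c → proj₂ (to (x , i)) ≡ proj₂ (to (c ∙ x , i)) ×
                                   RimAdj (proj₁ (to (x , i))) (proj₁ (to (c ∙ x , i)))
      rim-image x i Rc =
        notInTwo⇒rim (map (rim-step x i Rc)) (rim-notInTwo (R-step x Rc) ∘ inTwo-reflected)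

      vertex : Carrier → Carrier
      vertex x = proj₁ (to (x , 0F))

      layer : Fin 2 → Fin 2
      layer i = proj₂ (to (ε , i))

      to-decomposes : ∀ x i → to (x , i) ≡ (vertex x , layer i)
      to-decomposes x i = cong₂ _,_ (vertex-constant i) (layer-constant i x)
        where
        vertex-constant : ∀ i → proj₁ (to (x , i)) ≡ vertex x
        vertex-constant 0F = refl
        vertex-constant 1F = sym (spoke-image x)
        layer-constant : ∀ i x → proj₂ (to (x , i)) ≡ layer i
        layer-constant i =
          generated connected _ refl λ Rc eq → trans (sym (proj₁ (rim-image _ i Rc))) eq

      vertex-injective : ∀ {x y} → vertex x ≡ vertex y → x ≡ y
      vertex-injective {x} {y} eq = cong proj₁ (to-injective (begin
        to (x , 0F)           ≡⟨ to-decomposes x 0F ⟩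
        (vertex x , layer 0F) ≡⟨ cong (_, layer 0F) eq ⟩
        (vertex y , layer 0F) ≡⟨ to-decomposes y 0F ⟨
        to (y , 0F)           ∎))
        where open ≡-Reasoning

      open RimAutomorphism vertex vertex-injective (λ x Rc → proj₂ (rim-image x 0F Rc))

      normalises : ∀ g → ∃[ h ] ∀ v → to (ρ g (from v)) ≡ ρ h v
      normalises g with translational g
      ... | h , vertex-g = h , λ v → trans (conjugate (from v)) (cong (ρ h) (strictlyInverseˡ v))
        where
        conjugate : ∀ w → to (ρ g w) ≡ ρ h (to w)
        conjugate (y , i) = begin
          to (y ∙ g , i)              ≡⟨ to-decomposes (y ∙ g) i ⟩
          (vertex (y ∙ g) , layer i)  ≡⟨ cong (λ t → (vertex t , layer i)) (comm y g) ⟩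
          (vertex (g ∙ y) , layer i)  ≡⟨ cong (_, layer i) (vertex-g y) ⟩
          (h ∙ vertex y , layer i)    ≡⟨ cong (_, layer i) (comm h (vertex y)) ⟩
          (vertex y ∙ h , layer i)    ≡⟨ cong (ρ h) (to-decomposes y i) ⟨
          ρ h (to (y , i))            ∎
          where open ≡-Reasoning

    normal : Normal
    normal σ = Automorphism.normalises σ

    condition₃ : ∀ {k} → HasOrder a k → Condition₃
    condition₃ {k} hasOrder =
      a , k , R⇔ , hasOrder , pow4≢ε⇒order (a²≢a⁻² ∘ Equivalence.to (pow4≡ε⇔ a)) hasOrder

  inverse-pair : ∀ {a b} → (∀ x → R x ⇔ (x ≡ a ⊎ x ≡ b)) → (∀ x → R x → R (x ⁻¹)) →
                 a ∙ a ≢ b ∙ b → b ≡ a ⁻¹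
  inverse-pair {a} {b} R⇔ R⁻¹ a²≢b²
    with Equivalence.to (R⇔ (a ⁻¹)) (R⁻¹ a (Equivalence.from (R⇔ a) (inj₁ refl)))
       | Equivalence.to (R⇔ (b ⁻¹)) (R⁻¹ b (Equivalence.from (R⇔ b) (inj₂ refl)))
  ... | inj₂ a⁻¹≡b | _          = sym a⁻¹≡b
  ... | inj₁ _     | inj₁ b⁻¹≡a = trans (sym (⁻¹-involutive b)) (cong _⁻¹ b⁻¹≡a)
  ... | inj₁ a⁻¹≡a | inj₂ b⁻¹≡b = ⊥-elim (a²≢b² (trans (square≡ε a⁻¹≡a) (sym (square≡ε b⁻¹≡b))))
    where
    square≡ε : ∀ {x} → x ⁻¹ ≡ x → x ∙ x ≡ ε
    square≡ε {x} x⁻¹≡x = trans (cong (x ∙_) (sym x⁻¹≡x)) (inverseʳ x)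

lemma3p6 : ∀ {c ℓ : Level} (G : AbelianGroup c ℓ) → IsFiniteAbelian G →
  let open AbelianGroup G
      open SC G
  in (∃[ x ] x ≢ ε) →
     (R : Carrier → Set c) →
     (∀ x → R x → R (x ⁻¹)) →
     ¬ R ε →
     (∃[ a ] ∃[ b ] (a ≢ b × (∀ x → R x ⇔ (x ≡ a ⊎ x ≡ b)))) →
     Graph.Connected R R →
     Graph.VertexTransitive R R
     × (Graph.Normal R R ⇔ (¬ Graph.ArcTransitive R R))
     × ((¬ Graph.ArcTransitive R R) ⇔
        (∃[ a ] ∃[ k ] ((∀ x → R x ⇔ (x ≡ a ⊎ x ≡ a ⁻¹))
                        × HasOrder a k × 2 < k × k ≢ 4)))
lemma3p6 G fin _ R R⁻¹ ε∉R (a , b , a≢b , R⇔) connected =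
  vertexTransitive , classify (a ∙ a ≟ b ∙ b)
  where
  open AbelianGroup G using (_∙_)
  open FiniteAbelianGroup G fin using (_≟_; order)
  open SCGraph G (IsFiniteAbelian.≈⇒≡ fin) R
  open SC.Graph G R R using (Normal; ArcTransitive)
  classify : Dec (a ∙ a ≡ b ∙ b) → (Normal ⇔ (¬ ArcTransitive)) × ((¬ ArcTransitive) ⇔ Condition₃)
  classify (yes a²≡b²) =
    mk⇔ (⊥-elim ∘ arcTransitive⇒¬normal Ra arcTransitive) (λ ¬at → ⊥-elim (¬at arcTransitive)) ,
    mk⇔ (λ ¬at → ⊥-elim (¬at arcTransitive)) (⊥-elim ∘ ¬condition₃)
    where open CubeCase connected R⇔ a≢b ε∉R R⁻¹ a²≡b²
  classify (no a²≢b²) with inverse-pair R⇔ R⁻¹ a²≢b²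
  ... | refl =
    mk⇔ (λ _ → ¬arcTransitive) (λ _ → normal) ,
    mk⇔ (λ _ → condition₃ (proj₂ (order a))) (λ _ → ¬arcTransitive)
    where open PrismCase connected R⇔ a²≢b²
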